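{- Let $s=(s_0,\dots,s_{n-1})$ be a nonempty score sequence of length $n$ and let $j\in\{1,\dots,n-1\}$. Then $s+j$ is a score sequence if and only if there are score sequences $u$ and $v$ with $v$ of length $j$ such that $s=u\oplus v$. In that case, $s+j=v\oplus u$.
   Context: A score sequence is the nondecreasing sequence of out-degrees of the vertices of a tournament; equivalently (Landau), integers $(s_0,\dots,s_{n-1})$ with $0\le s_0\le\cdots\le s_{n-1}\le n-1$, $s_0+\dots+s_{k-1}\ge\binom{k}{2}$ for $1\le k<n$, and $s_0+\dots+s_{n-1}=\binom n2$. For a sequence $s$ of length $n$ and an integer $j$, $s+j$ denotes the sequence obtained by adding $j$ to each entry of $s$, reducing each result modulo $n$ to lie in $\{0,\dots,n-1\}$, and sorting in nondecreasing order. The direct sum of score sequences $u$ of length $k$ and $v$ is $u\oplus v=uv'$, the concatenation of $u$ with the sequence $v'$ obtained by adding $k$ to each entry of $v$. -}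

module Defs where

open import Data.Nat using (ℕ; zero; suc; _+_; _∸_; _≤_; _<_; _%_; NonZero)
open import Data.Nat.Properties using (≤-decTotalOrder; ≤-totalOrder)
open import Data.Nat.Combinatorics using (_C_)
open import Data.List using (List; []; _∷_; length; map; take; _++_)
open import Data.List.Relation.Unary.All using (All)
import Data.List.Sort.InsertionSort as IS
open import Data.List.Relation.Unary.Sorted.TotalOrder ≤-totalOrder using (Sorted)
open import Data.Product using (_×_)
open import Data.Nat.ListAction using (sum)
open import Relation.Binary.PropositionalEquality using (_≡_)

sortℕ : List ℕ → List ℕ
sortℕ = IS.sort ≤-decTotalOrder

-- Score sequence (Landau's conditions), for a sequence s of length n:
--  * nondecreasing,
--  * every entry ≤ n - 1,
--  * s_0 + ... + s_{k-1} ≥ k choose 2 for 1 ≤ k < n,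
--  * s_0 + ... + s_{n-1} = n choose 2.
IsScoreSeq : List ℕ → Set
IsScoreSeq s =
  Sorted s ×
  All (λ x → x ≤ length s ∸ 1) s ×
  (∀ k → 1 ≤ k → k < length s → k C 2 ≤ sum (take k s)) ×
  (sum s ≡ length s C 2)

shiftSeq : (s : List ℕ) → .{{NonZero (length s)}} → ℕ → List ℕ
shiftSeq s j = sortℕ (map (λ x → (x + j) % length s) s)

_⊕_ : List ℕ → List ℕ → List ℕ
u ⊕ v = u ++ map (length u +_) v

{-# OPTIONS --safe #-}
-- If s = u ⊕ v with |v| = j, adding j modulo n = |u| + |v| sends u to j + u and
-- |u| + v to v, so s + j = v ⊕ u; direct sums of score sequences are score
-- sequences.  Conversely, cut the sorted s at t = n − j into a low block u and a
-- high block t + v.  Then s + j is a rearrangement of (j + u) v, and since s and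
-- s + j are score sequences of equal length their sums agree, which gives
-- |u|·j = |v|·t and hence |v| = j, i.e. s = u ⊕ v.  Now u and v inherit Landau's
-- inequalities from u ⊕ v = s and v ⊕ u = s + j respectively, and the total-sum
-- identity for u ⊕ v forces both to hold with equality at full length.
module Submission where

open import Defs
open import Data.Nat
open import Data.Nat.Properties
open import Data.Nat.DivMod using (_%_; m<n⇒m%n≡m; [m+n]%n≡m%n)
open import Data.Nat.Combinatorics using (_C_; nCk+nC[k+1]≡[n+1]C[k+1]; nC1≡n)
open import Data.Nat.ListAction using (sum)
open import Data.Nat.ListAction.Properties using (sum-++; sum-↭)
open import Data.Nat.Tactic.RingSolver using (solve-∀)
open import Data.List using (List; []; _∷_; length; map; take; _++_)
open import Data.List.Properties
  using (map-++; map-∘; map-cong-local; map-id-local; take-map; take-all; length-++; length-map; length-take)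
open import Data.List.Relation.Unary.All as All using (All; []; _∷_)
import Data.List.Relation.Unary.All.Properties as All
import Data.List.Relation.Unary.AllPairs.Properties as AllPairs
open import Data.List.Relation.Unary.Linked as Linked using ([]; [-]; _∷_)
import Data.List.Relation.Unary.Linked.Properties as Linked
open import Data.List.Relation.Unary.Sorted.TotalOrder ≤-totalOrder using (Sorted)
import Data.List.Relation.Unary.Sorted.TotalOrder.Properties as Sorted
open import Data.List.Relation.Binary.Permutation.Propositional using (_↭_; ↭⇒↭ₛ; ↭-trans)
open import Data.List.Relation.Binary.Permutation.Propositional.Properties using (↭-length; ++-comm)
open import Data.List.Relation.Binary.Pointwise using (Pointwise-≡⇒≡)
import Data.List.Sort.InsertionSort.Properties as InsertionSort
open import Data.Product using (_×_; _,_; ∃₂; proj₁; proj₂)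
open import Data.Sum using (inj₁; inj₂)
open import Function.Bundles using (_⇔_; mk⇔)
open import Relation.Nullary using (yes; no)
open import Relation.Binary.PropositionalEquality

suc-C2 : ∀ n → suc n C 2 ≡ n + n C 2
suc-C2 n = trans (sym (nCk+nC[k+1]≡[n+1]C[k+1] n 1)) (cong (_+ n C 2) (nC1≡n n))

+-C2 : ∀ a b → (a + b) C 2 ≡ a C 2 + b C 2 + a * b
+-C2 zero    b = sym (+-identityʳ (b C 2))
+-C2 (suc a) b = begin
  suc (a + b) C 2                        ≡⟨ suc-C2 (a + b) ⟩
  (a + b) + (a + b) C 2                  ≡⟨ cong ((a + b) +_) (+-C2 a b) ⟩
  (a + b) + (a C 2 + b C 2 + a * b)      ≡⟨ regroup a b (a C 2) (b C 2) ⟩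
  (a + a C 2) + b C 2 + (b + a * b)      ≡⟨ cong (λ z → z + b C 2 + (b + a * b)) (sym (suc-C2 a)) ⟩
  suc a C 2 + b C 2 + suc a * b          ∎
  where
  open ≡-Reasoning
  regroup : ∀ a b x y → (a + b) + (x + y + a * b) ≡ (a + x) + y + (b + a * b)
  regroup = solve-∀

+-≡-≥⇒≡ : ∀ {a b c d} → c ≤ a → d ≤ b → a + b ≡ c + d → a ≡ c × b ≡ d
+-≡-≥⇒≡ {a} {b} {c} {d} c≤a d≤b eq =
    ≤-antisym (+-cancelʳ-≤ b a c (subst (_≤ c + b) (sym eq) (+-monoʳ-≤ c d≤b))) c≤a
  , ≤-antisym (+-cancelˡ-≤ a b d (subst (_≤ a + d) (sym eq) (+-monoˡ-≤ d c≤a))) d≤b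

balanced-sizes : ∀ {p q t j} → 0 < t + j → p + q ≡ t + j → p * j ≡ q * t → q ≡ j
balanced-sizes {p} {q} {t} {j} 0<t+j p+q≡t+j pj≡qt =
  *-cancelʳ-≡ q j (t + j) {{>-nonZero 0<t+j}} (begin
    q * (t + j)        ≡⟨ *-distribˡ-+ q t j ⟩
    q * t + q * j      ≡⟨ cong (_+ q * j) (sym pj≡qt) ⟩
    p * j + q * j      ≡⟨ sym (*-distribʳ-+ j p q) ⟩
    (p + q) * j        ≡⟨ cong (_* j) p+q≡t+j ⟩
    (t + j) * j        ≡⟨ *-comm (t + j) j ⟩
    j * (t + j)        ∎)
  where open ≡-Reasoning

sum-map-+ : ∀ c xs → sum (map (c +_) xs) ≡ length xs * c + sum xs
sum-map-+ c []       = refl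
sum-map-+ c (x ∷ xs) = trans (cong ((c + x) +_) (sum-map-+ c xs)) (regroup c x (length xs) (sum xs))
  where
  regroup : ∀ c x n s → (c + x) + (n * c + s) ≡ (c + n * c) + (x + s)
  regroup = solve-∀

take-++ˡ : ∀ {k} (xs ys : List ℕ) → k ≤ length xs → take k (xs ++ ys) ≡ take k xs
take-++ˡ {zero}  xs       ys _         = refl
take-++ˡ {suc k} (x ∷ xs) ys (s≤s k≤n) = cong (x ∷_) (take-++ˡ xs ys k≤n)

take-++ʳ : ∀ k (xs ys : List ℕ) → take (length xs + k) (xs ++ ys) ≡ xs ++ take k ys
take-++ʳ k []       ys = refl
take-++ʳ k (x ∷ xs) ys = cong (x ∷_) (take-++ʳ k xs ys)

map-+-∸ : ∀ {t xs} → All (t ≤_) xs → map (t +_) (map (_∸ t) xs) ≡ xs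
map-+-∸ {t} {xs} t≤xs = trans (sym (map-∘ xs)) (map-id-local (All.map (m+[n∸m]≡n) t≤xs))

sort-unique : ∀ {xs ys} → Sorted xs → ys ↭ xs → sortℕ ys ≡ xs
sort-unique {ys = ys} xs↗ ys↭xs = Pointwise-≡⇒≡ (Sorted.↗↭↗⇒≋ ≤-totalOrder
  (InsertionSort.sort-↗ ≤-decTotalOrder ys) xs↗
  (↭⇒↭ₛ (↭-trans (InsertionSort.sort-↭ ≤-decTotalOrder ys) ys↭xs)))

sum-sort : ∀ xs → sum (sortℕ xs) ≡ sum xs
sum-sort xs = sum-↭ (InsertionSort.sort-↭ ≤-decTotalOrder xs)

length-sort : ∀ xs → length (sortℕ xs) ≡ length xs
length-sort xs = ↭-length (InsertionSort.sort-↭ ≤-decTotalOrder xs)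

sorted-++ : ∀ t {xs ys} → Sorted xs → Sorted ys → All (_< t) xs → All (t ≤_) ys → Sorted (xs ++ ys)
sorted-++ t xs↗ ys↗ xs<t t≤ys = Sorted.AllPairs⇒Sorted ≤-totalOrder (AllPairs.++⁺
  (Sorted.Sorted⇒AllPairs ≤-totalOrder xs↗) (Sorted.Sorted⇒AllPairs ≤-totalOrder ys↗)
  (All.map (λ x<t → All.map (≤-trans (<⇒≤ x<t)) t≤ys) xs<t))

sorted-++⁻ : ∀ xs {ys} → Sorted (xs ++ ys) → Sorted xs × Sorted ys
sorted-++⁻ []           ys↗       = [] , ys↗
sorted-++⁻ (x ∷ [])     xys↗      = [-] , Linked.tail xys↗
sorted-++⁻ (x ∷ y ∷ xs) (x≤y ∷ r) with sorted-++⁻ (y ∷ xs) r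
... | yxs↗ , ys↗ = x≤y ∷ yxs↗ , ys↗

sorted-map-+ : ∀ c {xs} → Sorted xs → Sorted (map (c +_) xs)
sorted-map-+ c = Sorted.map⁺ ≤-totalOrder ≤-totalOrder (+-monoʳ-≤ c)

sorted-map-+⁻ : ∀ c {xs} → Sorted (map (c +_) xs) → Sorted xs
sorted-map-+⁻ c = Sorted.map⁻ ≤-totalOrder ≤-totalOrder (+-cancelˡ-≤ c _ _)

sorted-cut : ∀ t j {xs} → Sorted xs → All (_< t + j) xs →
  ∃₂ λ us vs → xs ≡ us ++ map (t +_) vs × All (_< t) us × All (_< j) vs
sorted-cut t j {[]}     _   _ = [] , [] , refl , [] , []
sorted-cut t j {x ∷ xs} xs↗ (x<t+j ∷ xs<t+j) with x <? t
... | yes x<t with sorted-cut t j (Linked.tail xs↗) xs<t+j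
...   | us , vs , eq , us<t , vs<j = x ∷ us , vs , cong (x ∷_) eq , x<t ∷ us<t , vs<j
sorted-cut t j {x ∷ xs} xs↗ x∷xs<t+j | no x≮t =
  [] , map (_∸ t) (x ∷ xs) , sym (map-+-∸ t≤x∷xs) , [] ,
  All.map⁺ (All.zipWith (λ (t≤y , y<t+j) → ∸-below t≤y y<t+j) (t≤x∷xs , x∷xs<t+j))
  where
  t≤x∷xs : All (t ≤_) (x ∷ xs)
  t≤x∷xs = Linked.Linked⇒All ≤-trans (≮⇒≥ x≮t) xs↗
  ∸-below : ∀ {y} → t ≤ y → y < t + j → y ∸ t < j
  ∸-below {y} t≤y y<t+j = +-cancelˡ-< t (y ∸ t) j (subst (_< t + j) (sym (m+[n∸m]≡n t≤y)) y<t+j)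

-- Landau's inequalities for all 0 ≤ k ≤ length s: unlike IsScoreSeq this also
-- covers k = length s, which lets summands of a direct sum inherit them.
Landau : List ℕ → Set
Landau s = ∀ k → k ≤ length s → k C 2 ≤ sum (take k s)

score-bounded : ∀ {s} → IsScoreSeq s → All (_< length s) s
score-bounded {[]}    _               = []
score-bounded {x ∷ s} (_ , s≤ , _ , _) = All.map m≤pred[n]⇒suc[m]≤n s≤

score-landau : ∀ {s} → IsScoreSeq s → Landau s
score-landau {s} (_ , _ , prefix , total) k k≤n with m≤n⇒m<n∨m≡n k≤n
... | inj₂ k≡n = subst (λ i → i C 2 ≤ sum (take i s)) (sym k≡n)
  (≤-reflexive (trans (sym total) (cong sum (sym (take-all (length s) s ≤-refl)))))
... | inj₁ k<n with k
...   | zero  = z≤n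
...   | suc i = prefix (suc i) (s≤s z≤n) k<n

mkScoreSeq : ∀ {s} → Sorted s → All (_< length s) s → Landau s → sum s ≡ length s C 2 → IsScoreSeq s
mkScoreSeq s↗ s< landau total =
  s↗ , All.map suc[m]≤n⇒m≤pred[n] s< , (λ k _ k<n → landau k (<⇒≤ k<n)) , total

length-⊕ : ∀ u v → length (u ⊕ v) ≡ length u + length v
length-⊕ u v = trans (length-++ u) (cong (length u +_) (length-map _ v))

sum-⊕ : ∀ u v → sum (u ⊕ v) ≡ sum u + sum v + length u * length v
sum-⊕ u v = trans (sum-++ u _) (trans (cong (sum u +_) (sum-map-+ (length u) v))
  (regroup (sum u) (sum v) (length u) (length v)))
  where
  regroup : ∀ x y a b → x + (b * a + y) ≡ x + y + a * b
  regroup = solve-∀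

length-⊕-C2 : ∀ u v → length (u ⊕ v) C 2 ≡ length u C 2 + length v C 2 + length u * length v
length-⊕-C2 u v = trans (cong (_C 2) (length-⊕ u v)) (+-C2 (length u) (length v))

⊕-sum-≥ : ∀ {u v} → length u C 2 ≤ sum u → length v C 2 ≤ sum v → length (u ⊕ v) C 2 ≤ sum (u ⊕ v)
⊕-sum-≥ {u} {v} u≥ v≥ = subst₂ _≤_ (sym (length-⊕-C2 u v)) (sym (sum-⊕ u v))
  (+-monoˡ-≤ (length u * length v) (+-mono-≤ u≥ v≥))

⊕-sum-≡ : ∀ {u v} → sum u ≡ length u C 2 → sum v ≡ length v C 2 → sum (u ⊕ v) ≡ length (u ⊕ v) C 2
⊕-sum-≡ {u} {v} u≡ v≡ = trans (sum-⊕ u v) (trans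
  (cong (_+ length u * length v) (cong₂ _+_ u≡ v≡)) (sym (length-⊕-C2 u v)))

⊕-sum-≡⁻ : ∀ {u v} → sum (u ⊕ v) ≡ length (u ⊕ v) C 2 → sum u + sum v ≡ length u C 2 + length v C 2
⊕-sum-≡⁻ {u} {v} total = +-cancelʳ-≡ (length u * length v) _ _
  (trans (sym (sum-⊕ u v)) (trans total (length-⊕-C2 u v)))

sorted-⊕ : ∀ {u v} → Sorted u → Sorted v → All (_< length u) u → Sorted (u ⊕ v)
sorted-⊕ {u} {v} u↗ v↗ u< = sorted-++ (length u) u↗ (sorted-map-+ (length u) v↗) u<
  (All.map⁺ (All.universal (m≤m+n (length u)) v))

⊕-bounded : ∀ {u v} → All (_< length u) u → All (_< length v) v → All (_< length (u ⊕ v)) (u ⊕ v)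
⊕-bounded {u} {v} u< v< = subst (λ n → All (_< n) (u ⊕ v)) (sym (length-⊕ u v)) (All.++⁺
  (All.map (λ x<u → <-≤-trans x<u (m≤m+n (length u) (length v))) u<)
  (All.map⁺ (All.map (+-monoʳ-< (length u)) v<)))

take-⊕ : ∀ k u v → take (length u + k) (u ⊕ v) ≡ u ⊕ take k v
take-⊕ k u v = trans (take-++ʳ k u _) (cong (u ++_) (take-map k v))

⊕-landau : ∀ {u v} → Landau u → sum u ≡ length u C 2 → Landau v → Landau (u ⊕ v)
⊕-landau {u} {v} landau-u total-u landau-v k k≤n with k ≤? length u
... | yes k≤u = subst (λ xs → k C 2 ≤ sum xs) (sym (take-++ˡ u _ k≤u)) (landau-u k k≤u)
... | no k≰u  = begin
  k C 2                                ≡⟨ cong (_C 2) (sym k≡) ⟩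
  (length u + k') C 2                  ≡⟨ cong (_C 2) (sym length≡) ⟩
  length (u ⊕ take k' v) C 2           ≤⟨ ⊕-sum-≥ {u} (≤-reflexive (sym total-u)) landau-take ⟩
  sum (u ⊕ take k' v)                  ≡⟨ cong sum (sym (take-⊕ k' u v)) ⟩
  sum (take (length u + k') (u ⊕ v))   ≡⟨ cong (λ i → sum (take i (u ⊕ v))) k≡ ⟩
  sum (take k (u ⊕ v))                 ∎
  where
  open ≤-Reasoning
  k' = k ∸ length u
  k≡ : length u + k' ≡ k
  k≡ = m+[n∸m]≡n (<⇒≤ (≰⇒> k≰u))
  k'≤v : k' ≤ length v
  k'≤v = +-cancelˡ-≤ (length u) k' (length v) (subst₂ _≤_ (sym k≡) (length-⊕ u v) k≤n)
  length-take≡ : length (take k' v) ≡ k'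
  length-take≡ = trans (length-take k' v) (m≤n⇒m⊓n≡m k'≤v)
  length≡ : length (u ⊕ take k' v) ≡ length u + k'
  length≡ = trans (length-⊕ u _) (cong (length u +_) length-take≡)
  landau-take : length (take k' v) C 2 ≤ sum (take k' v)
  landau-take = subst (λ i → i C 2 ≤ sum (take k' v)) (sym length-take≡) (landau-v k' k'≤v)

⊕-landau⁻ : ∀ {u v} → Landau (u ⊕ v) → Landau u
⊕-landau⁻ {u} {v} landau k k≤u = subst (λ xs → k C 2 ≤ sum xs) (take-++ˡ u _ k≤u)
  (landau k (≤-trans k≤u (subst (length u ≤_) (sym (length-⊕ u v)) (m≤m+n (length u) (length v)))))

landau-total : ∀ {s} → Landau s → length s C 2 ≤ sum s
landau-total {s} landau =
  subst (λ xs → length s C 2 ≤ sum xs) (take-all (length s) s ≤-refl) (landau (length s) ≤-refl)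

⊕-isScoreSeq : ∀ {u v} → IsScoreSeq u → IsScoreSeq v → IsScoreSeq (u ⊕ v)
⊕-isScoreSeq {u} {v} su@(u↗ , _ , _ , total-u) sv@(v↗ , _ , _ , total-v) = mkScoreSeq
  (sorted-⊕ u↗ v↗ (score-bounded su))
  (⊕-bounded (score-bounded su) (score-bounded sv))
  (⊕-landau (score-landau su) total-u (score-landau sv))
  (⊕-sum-≡ {u} {v} total-u total-v)

⊕-summands-isScoreSeq : ∀ {u v} → Sorted u → Sorted v → All (_< length u) u → All (_< length v) v →
  IsScoreSeq (u ⊕ v) → IsScoreSeq (v ⊕ u) → IsScoreSeq u × IsScoreSeq v
⊕-summands-isScoreSeq {u} {v} u↗ v↗ u< v< suv svu =
  mkScoreSeq u↗ u< landau-u (proj₁ tight) , mkScoreSeq v↗ v< landau-v (proj₂ tight)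
  where
  landau-u = ⊕-landau⁻ {u} {v} (score-landau suv)
  landau-v = ⊕-landau⁻ {v} {u} (score-landau svu)
  tight = +-≡-≥⇒≡ (landau-total landau-u) (landau-total landau-v)
    (⊕-sum-≡⁻ {u} {v} (proj₂ (proj₂ (proj₂ suv))))

shift-++ : ∀ {m} .{{_ : NonZero m}} {t j us vs} → t + j ≡ m → All (_< t) us → All (_< j) vs →
  map (λ x → (x + j) % m) (us ++ map (t +_) vs) ≡ map (j +_) us ++ vs
shift-++ {m} {t} {j} {us} {vs} t+j≡m us<t vs<j = begin
  map f (us ++ map (t +_) vs)         ≡⟨ map-++ f us _ ⟩
  map f us ++ map f (map (t +_) vs)   ≡⟨ cong₂ _++_ (map-cong-local (All.map low us<t)) high-block ⟩
  map (j +_) us ++ vs                 ∎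
  where
  open ≡-Reasoning
  f = λ x → (x + j) % m
  low : ∀ {x} → x < t → f x ≡ j + x
  low {x} x<t = trans (m<n⇒m%n≡m (subst (x + j <_) t+j≡m (+-monoˡ-< j x<t))) (+-comm x j)
  high : ∀ {y} → y < j → f (t + y) ≡ y
  high {y} y<j = begin
    (t + y + j) % m    ≡⟨ cong (_% m) (trans (regroup t y j) (cong (y +_) t+j≡m)) ⟩
    (y + m) % m        ≡⟨ [m+n]%n≡m%n y m ⟩
    y % m              ≡⟨ m<n⇒m%n≡m (<-≤-trans y<j (subst (j ≤_) t+j≡m (m≤n+m j t))) ⟩
    y                  ∎
    where
    regroup : ∀ t y j → t + y + j ≡ y + (t + j)
    regroup = solve-∀
  high-block : map f (map (t +_) vs) ≡ vs
  high-block = trans (sym (map-∘ vs)) (map-id-local (All.map high vs<j))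

shiftSeq-⊕ : ∀ {s} .{{_ : NonZero (length s)}} {u v j} → s ≡ u ⊕ v → length v ≡ j →
  Sorted u → Sorted v → All (_< length u) u → All (_< length v) v → shiftSeq s j ≡ v ⊕ u
shiftSeq-⊕ {u = u} {v} refl refl u↗ v↗ u< v< = trans
  (cong sortℕ (shift-++ (sym (length-⊕ u v)) u< v<))
  (sort-unique (sorted-⊕ v↗ u↗ v<) (++-comm _ v))

cut-balanced : ∀ {t j} us vs → 0 < t + j → length us + length vs ≡ t + j →
  sum (map (j +_) us ++ vs) ≡ sum (us ++ map (t +_) vs) → length us ≡ t × length vs ≡ j
cut-balanced {t} {j} us vs 0<t+j lengths sums =
  +-cancelʳ-≡ j _ _ (trans (cong (length us +_) (sym vs≡j)) lengths) , vs≡j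
  where
  regroupˡ : ∀ a b c → a + b + c ≡ a + (b + c)
  regroupˡ = solve-∀
  regroupʳ : ∀ a b c → b + (a + c) ≡ a + (b + c)
  regroupʳ = solve-∀
  weights : length us * j ≡ length vs * t
  weights = +-cancelʳ-≡ (sum us + sum vs) _ _ (begin
    length us * j + (sum us + sum vs)   ≡⟨ sym (regroupˡ (length us * j) (sum us) (sum vs)) ⟩
    length us * j + sum us + sum vs     ≡⟨ cong (_+ sum vs) (sym (sum-map-+ j us)) ⟩
    sum (map (j +_) us) + sum vs        ≡⟨ sym (sum-++ (map (j +_) us) vs) ⟩
    sum (map (j +_) us ++ vs)           ≡⟨ sums ⟩
    sum (us ++ map (t +_) vs)           ≡⟨ sum-++ us _ ⟩
    sum us + sum (map (t +_) vs)        ≡⟨ cong (sum us +_) (sum-map-+ t vs) ⟩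
    sum us + (length vs * t + sum vs)   ≡⟨ regroupʳ (length vs * t) (sum us) (sum vs) ⟩
    length vs * t + (sum us + sum vs)   ∎)
    where open ≡-Reasoning
  vs≡j : length vs ≡ j
  vs≡j = balanced-sizes 0<t+j lengths weights

shift-isScoreSeq⇒⊕ : ∀ {s} .{{_ : NonZero (length s)}} {j} → 0 < j → j < length s →
  IsScoreSeq s → IsScoreSeq (shiftSeq s j) →
  ∃₂ λ u v → IsScoreSeq u × IsScoreSeq v × length v ≡ j × s ≡ u ⊕ v
shift-isScoreSeq⇒⊕ {s} {j} 0<j j<n ss@(s↗ , _ , _ , total) shifted
  with sorted-cut (length s ∸ j) j s↗
         (subst (λ m → All (_< m) s) (sym (m∸n+n≡m (<⇒≤ j<n))) (score-bounded ss))
... | u , v , s≡ , u<t , v<j = u , v , proj₁ summands , proj₂ summands , v≡j , s≡u⊕v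
  where
  n = length s
  t = n ∸ j
  t+j≡n : t + j ≡ n
  t+j≡n = m∸n+n≡m (<⇒≤ j<n)
  f = λ x → (x + j) % n
  sums : sum (map (j +_) u ++ v) ≡ sum (u ++ map (t +_) v)
  sums = begin
    sum (map (j +_) u ++ v)     ≡⟨ cong sum (sym (trans (cong (map f) s≡) (shift-++ t+j≡n u<t v<j))) ⟩
    sum (map f s)               ≡⟨ sym (sum-sort (map f s)) ⟩
    sum (shiftSeq s j)          ≡⟨ proj₂ (proj₂ (proj₂ shifted)) ⟩
    length (shiftSeq s j) C 2   ≡⟨ cong (_C 2) (trans (length-sort (map f s)) (length-map f s)) ⟩
    n C 2                       ≡⟨ sym total ⟩
    sum s                       ≡⟨ cong sum s≡ ⟩
    sum (u ++ map (t +_) v)     ∎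
    where open ≡-Reasoning
  lengths : length u + length v ≡ t + j
  lengths = begin
    length u + length v                ≡⟨ cong (length u +_) (sym (length-map (t +_) v)) ⟩
    length u + length (map (t +_) v)   ≡⟨ sym (length-++ u) ⟩
    length (u ++ map (t +_) v)         ≡⟨ cong length (sym s≡) ⟩
    n                                  ≡⟨ sym t+j≡n ⟩
    t + j                              ∎
    where open ≡-Reasoning
  balanced = cut-balanced u v (<-≤-trans 0<j (m≤n+m j t)) lengths sums
  v≡j = proj₂ balanced
  s≡u⊕v : s ≡ u ⊕ v
  s≡u⊕v = trans s≡ (cong (λ c → u ++ map (c +_) v) (sym (proj₁ balanced)))
  halves↗ = sorted-++⁻ u (subst Sorted s≡ s↗)
  u↗ = proj₁ halves↗
  v↗ = sorted-map-+⁻ t (proj₂ halves↗)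
  u< = subst (λ m → All (_< m) u) (sym (proj₁ balanced)) u<t
  v< = subst (λ m → All (_< m) v) (sym v≡j) v<j
  summands = ⊕-summands-isScoreSeq u↗ v↗ u< v< (subst IsScoreSeq s≡u⊕v ss)
    (subst IsScoreSeq (shiftSeq-⊕ s≡u⊕v v≡j u↗ v↗ u< v<) shifted)

lemma7 : (s : List ℕ) → .{{_ : NonZero (length s)}} → IsScoreSeq s →
    (j : ℕ) → 1 ≤ j → j < length s →
      (IsScoreSeq (shiftSeq s j) ⇔
        ∃₂ λ u v → IsScoreSeq u × IsScoreSeq v × length v ≡ j × s ≡ u ⊕ v)
      × (∀ u v → IsScoreSeq u → IsScoreSeq v → length v ≡ j → s ≡ u ⊕ v →
          shiftSeq s j ≡ v ⊕ u)
lemma7 s ss j 1≤j j<n = mk⇔ (shift-isScoreSeq⇒⊕ 1≤j j<n ss) ⊕⇒shift-isScoreSeq , shift≡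
  where
  shift≡ : ∀ u v → IsScoreSeq u → IsScoreSeq v → length v ≡ j → s ≡ u ⊕ v → shiftSeq s j ≡ v ⊕ u
  shift≡ u v su sv v≡j s≡ =
    shiftSeq-⊕ s≡ v≡j (proj₁ su) (proj₁ sv) (score-bounded su) (score-bounded sv)
  ⊕⇒shift-isScoreSeq : (∃₂ λ u v → IsScoreSeq u × IsScoreSeq v × length v ≡ j × s ≡ u ⊕ v) →
    IsScoreSeq (shiftSeq s j)
  ⊕⇒shift-isScoreSeq (u , v , su , sv , v≡j , s≡) =
    subst IsScoreSeq (sym (shift≡ u v su sv v≡j s≡)) (⊕-isScoreSeq sv su)
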